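{- For any job set $S'$ with $|S'|=t$ in a three-machine permutation flowshop, the number of distinct pairs $\langle C^M_2(\pi),C^M_3(\pi)\rangle$, where $\pi$ ranges over permutations of $S'$, is $O^*(4^t)$.
   Context: Three-machine flowshop: each job $i$ has non-negative integer processing times $p_{i1},p_{i2},p_{i3}$ on machines 1, 2, 3, processed in that order; each machine processes one job at a time. A permutation $\pi$ is scheduled from time $0$ as a permutation schedule (same order on all machines, every operation as early as possible); $C^M_j(\pi)$ is the completion time of the last job of $\pi$ on machine $j$. Notation: $f(t)=O^*(g(t))$ means $f(t)=O(p(t)g(t))$ for some polynomial $p$. -}

module Defs where

open import Data.Nat using (ℕ; _+_; _⊔_)
open import Data.Product using (_×_; _,_; proj₁; proj₂)
open import Data.List using (List; foldl; map; allFin)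
open import Data.Fin using (Fin)
open import Data.Fin.Permutation using (Permutation′; _⟨$⟩ʳ_)

-- A job: processing times (p₁ , p₂ , p₃) on machines 1, 2, 3.
Job : Set
Job = ℕ × ℕ × ℕ

-- Completion times (C¹, C², C³) of the last scheduled job on machines 1,2,3.
State : Set
State = ℕ × ℕ × ℕ

step : State → Job → State
step (c₁ , c₂ , c₃) (a , b , c) =
  let c₁' = c₁ + a
      c₂' = (c₁' ⊔ c₂) + b
      c₃' = (c₂' ⊔ c₃) + c
  in c₁' , c₂' , c₃'

schedule : List Job → State
schedule = foldl step (0 , 0 , 0)

sequence : ∀ {t} → (Fin t → Job) → Permutation′ t → List Job
sequence jobs π = map (λ k → jobs (π ⟨$⟩ʳ k)) (allFin _)

CM₂ : ∀ {t} → (Fin t → Job) → Permutation′ t → ℕ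
CM₂ jobs π = proj₁ (proj₂ (schedule (sequence jobs π)))

CM₃ : ∀ {t} → (Fin t → Job) → Permutation′ t → ℕ
CM₃ jobs π = proj₂ (proj₂ (schedule (sequence jobs π)))

-- In a permutation schedule C² and C³ are lengths of critical paths: the
-- C² path runs along machine 1 and drops to machine 2 at some job, the C³
-- path drops once more, to machine 3.  So every job contributes one of p₁,
-- p₂, p₃ to C² and one to C³, and the jobs where the paths drop contribute at
-- most three extra terms.  Scheduling job by job, the C² path restarts on
-- machine 1 whenever machine 2 idles and the C³ path becomes a copy of the C²
-- path whenever machine 3 idles; hence the C³ path never reaches machine 2
-- after the C² path, and the pairs of contributions form a staircase through
-- (p₁ , p₃) or through (p₂ , p₂), over one of two four-letter alphabets.  As
-- the contributions are attached to jobs rather than positions, (C² , C³) is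
-- determined by a shape, a letter per job and three optional jobs, whatever
-- the permutation: at most 2 · 4ᵗ · (t + 1)³ candidate pairs.
module Submission where

open import Defs
open import Data.Nat using (ℕ; zero; suc; _+_; _*_; _^_; _⊔_; _≤_)
open import Data.Nat.Properties
  using (⊔-sel; ≤-reflexive; +-commutativeSemigroup; +-0-commutativeMonoid)
open import Data.Nat.Tactic.RingSolver using (solve-∀)
open import Data.Product using (Σ; _×_; _,_)
open import Data.Sum using (inj₁; inj₂)
open import Data.Maybe as Maybe using (Maybe; nothing; just)
open import Data.List
  using (List; []; _∷_; _∷ʳ_; _++_; length; map; tabulate; allFin;
         cartesianProduct; cartesianProductWith)
open import Data.List.Properties
  using (foldl-∷ʳ; map-tabulate; length-map; length-++; length-tabulate)
open import Data.List.Membership.Propositional using (_∈_)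
open import Data.List.Membership.Propositional.Properties
  using (∈-map⁺; ∈-++⁺ˡ; ∈-++⁺ʳ; ∈-allFin; ∈-cartesianProduct⁺;
         ∈-cartesianProductWith⁺)
open import Data.List.Relation.Unary.Any using (here; there)
open import Data.Fin using (Fin; zero; suc; inject₁; fromℕ)
open import Data.Fin.Permutation using (Permutation′; _⟨$⟩ʳ_; _⟨$⟩ˡ_; inverseˡ)
open import Data.Vec using (Vec; []; _∷_; lookup)
import Data.Vec as Vec
open import Data.Vec.Properties using (lookup∘tabulate)
open import Data.Vec.Functional using (init; last)
open import Function using (_∘_)
open import Relation.Binary.PropositionalEquality
  using (_≡_; refl; sym; trans; cong; cong₂; subst; module ≡-Reasoning)
open import Algebra.Properties.CommutativeMonoid.Sum +-0-commutativeMonoid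
  using (sum; sum-cong-≗; sum-init-last; sum-permute)
open import Algebra.Properties.CommutativeSemigroup +-commutativeSemigroup
  using (xy∙z≈xz∙y)

p₁ p₂ p₃ : Job → ℕ
p₁ (a , b , c) = a
p₂ (a , b , c) = b
p₃ (a , b , c) = c

C¹ C² C³ : State → ℕ
C¹ (c₁ , c₂ , c₃) = c₁
C² (c₁ , c₂ , c₃) = c₂
C³ (c₁ , c₂ , c₃) = c₃

C¹-step : ∀ s x → C¹ (step s x) ≡ C¹ s + p₁ x
C¹-step (c₁ , c₂ , c₃) (a , b , c) = refl

C²-step : ∀ s x → C² (step s x) ≡ (C¹ s + p₁ x) ⊔ C² s + p₂ x
C²-step (c₁ , c₂ , c₃) (a , b , c) = refl

C³-step : ∀ s x → C³ (step s x) ≡ C² (step s x) ⊔ C³ s + p₃ x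
C³-step (c₁ , c₂ , c₃) (a , b , c) = refl

snoc : ∀ {n} {A : Set} → (Fin n → A) → A → Fin (suc n) → A
snoc {zero}  f y zero    = y
snoc {suc n} f y zero    = f zero
snoc {suc n} f y (suc k) = snoc (f ∘ suc) y k

init-snoc : ∀ {n} {A : Set} (f : Fin n → A) (y : A) k → init (snoc f y) k ≡ f k
init-snoc {suc n} f y zero    = refl
init-snoc {suc n} f y (suc k) = init-snoc (f ∘ suc) y k

last-snoc : ∀ {n} {A : Set} (f : Fin n → A) (y : A) → last (snoc f y) ≡ y
last-snoc {zero}  f y = refl
last-snoc {suc n} f y = last-snoc (f ∘ suc) y

tabulate-init-last : ∀ {n} {A : Set} (f : Fin (suc n) → A) →
  tabulate f ≡ tabulate (init f) ∷ʳ last f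
tabulate-init-last {zero}  f = refl
tabulate-init-last {suc n} f = cong (f zero ∷_) (tabulate-init-last (f ∘ suc))

schedule-init-last : ∀ {n} (g : Fin (suc n) → Job) →
  schedule (map g (allFin (suc n))) ≡ step (schedule (map (init g) (allFin n))) (last g)
schedule-init-last {n} g = begin
  schedule (map g (allFin (suc n)))                ≡⟨ cong schedule (map-tabulate (λ k → k) g) ⟩
  schedule (tabulate g)                            ≡⟨ cong schedule (tabulate-init-last g) ⟩
  schedule (tabulate (init g) ∷ʳ last g)           ≡⟨ foldl-∷ʳ step _ (last g) (tabulate (init g)) ⟩
  step (schedule (tabulate (init g))) (last g)     ≡⟨ cong (λ js → step (schedule js) (last g))
                                                         (map-tabulate (λ k → k) (init g)) ⟨
  step (schedule (map (init g) (allFin n))) (last g) ∎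
  where open ≡-Reasoning

C¹-schedule : ∀ n (g : Fin n → Job) → C¹ (schedule (map g (allFin n))) ≡ sum (p₁ ∘ g)
C¹-schedule zero    g = refl
C¹-schedule (suc n) g = begin
  C¹ (schedule (map g (allFin (suc n))))  ≡⟨ cong C¹ (schedule-init-last g) ⟩
  C¹ (step s (last g))                    ≡⟨ C¹-step s (last g) ⟩
  C¹ s + p₁ (last g)                      ≡⟨ cong (_+ p₁ (last g)) (C¹-schedule n (init g)) ⟩
  sum (p₁ ∘ init g) + p₁ (last g)         ≡⟨ sum-init-last (p₁ ∘ g) ⟨
  sum (p₁ ∘ g)                            ∎
  where
  open ≡-Reasoning
  s = schedule (map (init g) (allFin n))

-- A cell records which of p₁, p₂, p₃ (written a, b, c) a job contributes to
-- C² and to C³; the shape says which of ac and bb the cells may use.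
data Shape : Set where
  viaAC viaBB : Shape

data Cell : Shape → Set where
  aa ab bc : ∀ {σ} → Cell σ
  ac : Cell viaAC
  bb : Cell viaBB

cells : (σ : Shape) → List (Cell σ)
cells viaAC = aa ∷ ab ∷ ac ∷ bc ∷ []
cells viaBB = aa ∷ ab ∷ bb ∷ bc ∷ []

∈-cells : ∀ {σ} (x : Cell σ) → x ∈ cells σ
∈-cells {viaAC} aa = here refl
∈-cells {viaBB} aa = here refl
∈-cells {viaAC} ab = there (here refl)
∈-cells {viaBB} ab = there (here refl)
∈-cells ac = there (there (here refl))
∈-cells bb = there (there (here refl))
∈-cells {viaAC} bc = there (there (there (here refl)))
∈-cells {viaBB} bc = there (there (there (here refl)))

w₂ w₃ : ∀ {σ} → Cell σ → Job → ℕ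
w₂ aa = p₁
w₂ ab = p₁
w₂ ac = p₁
w₂ bb = p₂
w₂ bc = p₂
w₃ aa = p₁
w₃ ab = p₂
w₃ ac = p₃
w₃ bb = p₂
w₃ bc = p₃

restart₂ : ∀ {σ} → Cell σ → Cell viaAC
restart₂ aa = aa
restart₂ ab = ab
restart₂ ac = ac
restart₂ bb = ab
restart₂ bc = ac

restart₃ : ∀ {σ} → Cell σ → Cell viaBB
restart₃ aa = aa
restart₃ ab = aa
restart₃ ac = aa
restart₃ bb = bb
restart₃ bc = bb

w₂-restart₂ : ∀ {σ} (x : Cell σ) j → w₂ (restart₂ x) j ≡ p₁ j
w₂-restart₂ aa j = refl
w₂-restart₂ ab j = refl
w₂-restart₂ ac j = refl
w₂-restart₂ bb j = refl
w₂-restart₂ bc j = refl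

w₃-restart₂ : ∀ {σ} (x : Cell σ) j → w₃ (restart₂ x) j ≡ w₃ x j
w₃-restart₂ aa j = refl
w₃-restart₂ ab j = refl
w₃-restart₂ ac j = refl
w₃-restart₂ bb j = refl
w₃-restart₂ bc j = refl

w₂-restart₃ : ∀ {σ} (x : Cell σ) j → w₂ (restart₃ x) j ≡ w₂ x j
w₂-restart₃ aa j = refl
w₂-restart₃ ab j = refl
w₂-restart₃ ac j = refl
w₂-restart₃ bb j = refl
w₂-restart₃ bc j = refl

w₃-restart₃ : ∀ {σ} (x : Cell σ) j → w₃ (restart₃ x) j ≡ w₂ x j
w₃-restart₃ aa j = refl
w₃-restart₃ ab j = refl
w₃-restart₃ ac j = refl
w₃-restart₃ bb j = refl
w₃-restart₃ bc j = refl

weight : ∀ {n} {A : Set} → (A → Job → ℕ) → (Fin n → A) → (Fin n → Job) → ℕ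
weight w cell g = sum (λ k → w (cell k) (g k))

weight-∘ : ∀ {n} {A B : Set} (v : B → Job → ℕ) (φ : A → B) {w : A → Job → ℕ} →
  (∀ x j → v (φ x) j ≡ w x j) → (cell : Fin n → A) (g : Fin n → Job) →
  weight v (φ ∘ cell) g ≡ weight w cell g
weight-∘ v φ vφ≡w cell g = sum-cong-≗ (λ k → vφ≡w (cell k) (g k))

weight-snoc : ∀ {n} {A : Set} (w : A → Job → ℕ) (cell : Fin n → A) (x : A)
  (g : Fin (suc n) → Job) →
  weight w (snoc cell x) g ≡ weight w cell (init g) + w x (last g)
weight-snoc w cell x g = trans (sum-init-last (λ k → w (snoc cell x k) (g k)))
  (cong₂ _+_ (sum-cong-≗ (λ k → cong (λ y → w y (init g k)) (init-snoc cell x k)))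
             (cong (λ y → w y (last g)) (last-snoc cell x)))

weight-permute : ∀ {n} {A : Set} (w : A → Job → ℕ) (cell : Fin n → A)
  (g : Fin n → Job) (π : Permutation′ n) →
  weight w (cell ∘ (π ⟨$⟩ˡ_)) g ≡ weight w cell (λ k → g (π ⟨$⟩ʳ k))
weight-permute w cell g π = trans (sum-permute (λ i → w (cell (π ⟨$⟩ˡ i)) (g i)) π)
  (sum-cong-≗ (λ k → cong (λ i → w (cell i) (g (π ⟨$⟩ʳ k))) (inverseˡ π)))

extra : ∀ {n} → (Job → ℕ) → (Fin n → Job) → Maybe (Fin n) → ℕ
extra f g nothing  = 0
extra f g (just k) = f (g k)

extra-map : ∀ {m n} (f : Job → ℕ) (g : Fin n → Job) (h : Fin m → Fin n) (i : Maybe (Fin m)) →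
  extra f g (Maybe.map h i) ≡ extra f (g ∘ h) i
extra-map f g h nothing  = refl
extra-map f g h (just k) = refl

-- corner₂ is the job at which the critical path of C² drops from machine 1
-- to machine 2 (contributing p₂ on top of its cell's p₁); corner₃ and
-- corner₃′ are the drops of the C³ path to machines 2 and 3.  They are
-- 'nothing' only for the empty sequence.
record Decomposition {n} (g : Fin n → Job) (c₂ c₃ : ℕ) : Set where
  field
    shape : Shape
    cell : Fin n → Cell shape
    corner₂ corner₃ corner₃′ : Maybe (Fin n)
    C²-eq : c₂ ≡ weight w₂ cell g + extra p₂ g corner₂
    C³-eq : c₃ ≡ weight w₃ cell g + extra p₂ g corner₃ + extra p₃ g corner₃′

decomposition-empty : (g : Fin 0 → Job) → Decomposition g 0 0
decomposition-empty g = record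
  { shape = viaAC ; cell = λ () ; corner₂ = nothing ; corner₃ = nothing ; corner₃′ = nothing
  ; C²-eq = refl ; C³-eq = refl }

decomposition-append : ∀ {n} (g : Fin (suc n) → Job) {c₂ c₃} →
  Decomposition (init g) c₂ c₃ →
  Decomposition g (c₂ + p₂ (last g)) (c₃ + p₃ (last g))
decomposition-append g {c₂} {c₃} D = record
  { shape = shape ; cell = snoc cell bc
  ; corner₂ = Maybe.map inject₁ corner₂
  ; corner₃ = Maybe.map inject₁ corner₃
  ; corner₃′ = Maybe.map inject₁ corner₃′
  ; C²-eq = begin
      c₂ + p₂ x                                   ≡⟨ cong (_+ p₂ x) C²-eq ⟩
      weight w₂ cell (init g) + e₂ + p₂ x         ≡⟨ xy∙z≈xz∙y _ e₂ (p₂ x) ⟩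
      weight w₂ cell (init g) + p₂ x + e₂         ≡⟨ cong₂ _+_ (weight-snoc w₂ cell bc g)
                                                         (extra-map p₂ g inject₁ corner₂) ⟨
      weight w₂ (snoc cell bc) g + extra p₂ g (Maybe.map inject₁ corner₂) ∎
  ; C³-eq = begin
      c₃ + p₃ x                                   ≡⟨ cong (_+ p₃ x) C³-eq ⟩
      weight w₃ cell (init g) + e₃ + e₃′ + p₃ x   ≡⟨ xy∙z≈xz∙y _ e₃′ (p₃ x) ⟩
      weight w₃ cell (init g) + e₃ + p₃ x + e₃′   ≡⟨ cong (_+ e₃′) (xy∙z≈xz∙y _ e₃ (p₃ x)) ⟩
      weight w₃ cell (init g) + p₃ x + e₃ + e₃′   ≡⟨ cong₂ _+_ (cong₂ _+_ (weight-snoc w₃ cell bc g)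
                                                         (extra-map p₂ g inject₁ corner₃))
                                                         (extra-map p₃ g inject₁ corner₃′) ⟨
      weight w₃ (snoc cell bc) g + extra p₂ g (Maybe.map inject₁ corner₃)
        + extra p₃ g (Maybe.map inject₁ corner₃′) ∎ }
  where
  open ≡-Reasoning
  open Decomposition D
  x = last g
  e₂ = extra p₂ (init g) corner₂
  e₃ = extra p₂ (init g) corner₃
  e₃′ = extra p₃ (init g) corner₃′

decomposition-restart₂ : ∀ {n} {g : Fin n → Job} {c₂ c₃} → Decomposition g c₂ c₃ →
  (k : Fin n) → Decomposition g (sum (p₁ ∘ g) + p₂ (g k)) c₃
decomposition-restart₂ {g = g} D k = record
  { shape = viaAC ; cell = restart₂ ∘ cell
  ; corner₂ = just k ; corner₃ = corner₃ ; corner₃′ = corner₃′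
  ; C²-eq = cong (_+ p₂ (g k)) (sym (weight-∘ w₂ restart₂ w₂-restart₂ cell g))
  ; C³-eq = trans C³-eq (cong (λ W → W + extra p₂ g corner₃ + extra p₃ g corner₃′)
                              (sym (weight-∘ w₃ restart₂ w₃-restart₂ cell g))) }
  where open Decomposition D

decomposition-restart₃ : ∀ {n} {g : Fin n → Job} {c₂ c₃} → Decomposition g c₂ c₃ →
  (k : Fin n) → Decomposition g c₂ (c₂ + p₃ (g k))
decomposition-restart₃ {g = g} D k = record
  { shape = viaBB ; cell = restart₃ ∘ cell
  ; corner₂ = corner₂ ; corner₃ = corner₂ ; corner₃′ = just k
  ; C²-eq = trans C²-eq (cong (_+ e₂) (sym (weight-∘ w₂ restart₃ w₂-restart₃ cell g)))
  ; C³-eq = cong (_+ p₃ (g k))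
      (trans C²-eq (cong (_+ e₂) (sym (weight-∘ w₃ restart₃ w₃-restart₃ cell g)))) }
  where
  open Decomposition D
  e₂ = extra p₂ g corner₂

decomposition-step : ∀ {n} (g : Fin (suc n) → Job) {s : State} →
  C¹ s ≡ sum (p₁ ∘ init g) → Decomposition (init g) (C² s) (C³ s) →
  Decomposition g (C² (step s (last g))) (C³ (step s (last g)))
decomposition-step {n} g {s} C¹-eq D = machine₃ (machine₂ (decomposition-append g D))
  where
  x = last g
  s′ = step s x
  machine₂ : Decomposition g (C² s + p₂ x) (C³ s + p₃ x) → Decomposition g (C² s′) (C³ s + p₃ x)
  machine₂ D′ with ⊔-sel (C¹ s + p₁ x) (C² s)
  ... | inj₁ idle = subst (λ c₂ → Decomposition g c₂ (C³ s + p₃ x))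
    (sym (trans (C²-step s x) (cong (_+ p₂ x) (trans idle
      (trans (cong (_+ p₁ x) C¹-eq) (sym (sum-init-last (p₁ ∘ g))))))))
    (decomposition-restart₂ D′ (fromℕ n))
  ... | inj₂ busy = subst (λ c₂ → Decomposition g c₂ (C³ s + p₃ x))
    (sym (trans (C²-step s x) (cong (_+ p₂ x) busy))) D′
  machine₃ : Decomposition g (C² s′) (C³ s + p₃ x) → Decomposition g (C² s′) (C³ s′)
  machine₃ D′ with ⊔-sel (C² s′) (C³ s)
  ... | inj₁ idle = subst (Decomposition g (C² s′))
    (sym (trans (C³-step s x) (cong (_+ p₃ x) idle))) (decomposition-restart₃ D′ (fromℕ n))
  ... | inj₂ busy = subst (Decomposition g (C² s′))
    (sym (trans (C³-step s x) (cong (_+ p₃ x) busy))) D′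

decomposition-schedule : ∀ n (g : Fin n → Job) →
  Decomposition g (C² (schedule (map g (allFin n)))) (C³ (schedule (map g (allFin n))))
decomposition-schedule zero    g = decomposition-empty g
decomposition-schedule (suc n) g rewrite schedule-init-last g =
  decomposition-step g (C¹-schedule n (init g)) (decomposition-schedule n (init g))

decomposition-unpermute : ∀ {n} {g : Fin n → Job} {c₂ c₃} (π : Permutation′ n) →
  Decomposition (λ k → g (π ⟨$⟩ʳ k)) c₂ c₃ → Decomposition g c₂ c₃
decomposition-unpermute {g = g} π D = record
  { shape = shape ; cell = cell ∘ (π ⟨$⟩ˡ_)
  ; corner₂ = Maybe.map (π ⟨$⟩ʳ_) corner₂
  ; corner₃ = Maybe.map (π ⟨$⟩ʳ_) corner₃
  ; corner₃′ = Maybe.map (π ⟨$⟩ʳ_) corner₃′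
  ; C²-eq = trans C²-eq (sym (cong₂ _+_ (weight-permute w₂ cell g π)
                                         (extra-map p₂ g (π ⟨$⟩ʳ_) corner₂)))
  ; C³-eq = trans C³-eq (sym (cong₂ _+_ (cong₂ _+_ (weight-permute w₃ cell g π)
                                                    (extra-map p₂ g (π ⟨$⟩ʳ_) corner₃))
                                         (extra-map p₃ g (π ⟨$⟩ʳ_) corner₃′))) }
  where open Decomposition D

vectors : {A : Set} → List A → ∀ n → List (Vec A n)
vectors xs zero    = [] ∷ []
vectors xs (suc n) = cartesianProductWith _∷_ xs (vectors xs n)

length-cartesianProductWith : {A B C : Set} (f : A → B → C) (xs : List A) (ys : List B) →
  length (cartesianProductWith f xs ys) ≡ length xs * length ys
length-cartesianProductWith f []       ys = refl
length-cartesianProductWith f (x ∷ xs) ys =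
  trans (length-++ (map (f x) ys))
        (cong₂ _+_ (length-map (f x) ys) (length-cartesianProductWith f xs ys))

length-vectors : {A : Set} (xs : List A) (n : ℕ) → length (vectors xs n) ≡ length xs ^ n
length-vectors xs zero    = refl
length-vectors xs (suc n) = trans (length-cartesianProductWith _∷_ xs (vectors xs n))
                                  (cong (length xs *_) (length-vectors xs n))

∈-vectors : {A : Set} {xs : List A} → (∀ x → x ∈ xs) → ∀ {n} (v : Vec A n) → v ∈ vectors xs n
∈-vectors ∈xs []      = here refl
∈-vectors ∈xs (x ∷ v) = ∈-cartesianProductWith⁺ _∷_ (∈xs x) (∈-vectors ∈xs v)

maybes : ∀ t → List (Maybe (Fin t))
maybes t = nothing ∷ map just (allFin t)

length-maybes : ∀ t → length (maybes t) ≡ suc t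
length-maybes t = cong suc (trans (length-map just (allFin t)) (length-tabulate _))

∈-maybes : ∀ {t} (m : Maybe (Fin t)) → m ∈ maybes t
∈-maybes nothing  = here refl
∈-maybes (just k) = there (∈-map⁺ just (∈-allFin k))

Profile : ℕ → Shape → Set
Profile t σ = Vec (Cell σ) t × Maybe (Fin t) × Maybe (Fin t) × Maybe (Fin t)

profiles : ∀ t σ → List (Profile t σ)
profiles t σ = cartesianProduct (vectors (cells σ) t)
  (cartesianProduct (maybes t) (cartesianProduct (maybes t) (maybes t)))

length-profiles : ∀ t σ → length (profiles t σ) ≡ 4 ^ t * (suc t * (suc t * suc t))
length-profiles t σ =
  trans (length-cartesianProductWith _,_ (vectors (cells σ) t) M³)
    (cong₂ _*_ (trans (length-vectors (cells σ) t) (cong (_^ t) (length-cells σ)))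
      (trans (length-cartesianProductWith _,_ (maybes t) M²)
        (cong₂ _*_ (length-maybes t)
          (trans (length-cartesianProductWith _,_ (maybes t) (maybes t))
                 (cong₂ _*_ (length-maybes t) (length-maybes t))))))
  where
  M² = cartesianProduct (maybes t) (maybes t)
  M³ = cartesianProduct (maybes t) M²
  length-cells : ∀ σ → length (cells σ) ≡ 4
  length-cells viaAC = refl
  length-cells viaBB = refl

completionTimes : ∀ {t σ} → (Fin t → Job) → Profile t σ → ℕ × ℕ
completionTimes g (r , k₂ , k₃ , k₃′) =
  weight w₂ (lookup r) g + extra p₂ g k₂ , weight w₃ (lookup r) g + extra p₂ g k₃ + extra p₃ g k₃′

candidates : ∀ {t} → (Fin t → Job) → List (ℕ × ℕ)
candidates {t} g = map (completionTimes g) (profiles t viaAC) ++ map (completionTimes g) (profiles t viaBB)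

length-candidates : ∀ {t} (g : Fin t → Job) → length (candidates g) ≡ 2 * suc t ^ 3 * 4 ^ t
length-candidates {t} g = begin
  length (candidates g)                  ≡⟨ length-++ (map (completionTimes g) (profiles t viaAC)) ⟩
  length (map _ (profiles t viaAC)) + length (map _ (profiles t viaBB))
    ≡⟨ cong₂ _+_ (length-map _ (profiles t viaAC)) (length-map _ (profiles t viaBB)) ⟩
  length (profiles t viaAC) + length (profiles t viaBB)
    ≡⟨ cong₂ _+_ (length-profiles t viaAC) (length-profiles t viaBB) ⟩
  P + P                                  ≡⟨ rearrange (4 ^ t) (suc t) ⟩
  2 * suc t ^ 3 * 4 ^ t                  ∎
  where
  open ≡-Reasoning
  P = 4 ^ t * (suc t * (suc t * suc t))
  rearrange : ∀ q s → q * (s * (s * s)) + q * (s * (s * s)) ≡ 2 * (s * (s * (s * 1))) * q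
  rearrange = solve-∀

decomposition-∈-candidates : ∀ {t} {g : Fin t → Job} {c₂ c₃} →
  Decomposition g c₂ c₃ → (c₂ , c₃) ∈ candidates g
decomposition-∈-candidates {t} {g} D =
  subst (_∈ candidates g)
    (sym (cong₂ _,_ (trans C²-eq (cong (_+ extra p₂ g corner₂) (lookup-weight w₂)))
                    (trans C³-eq (cong (λ W → W + extra p₂ g corner₃ + extra p₃ g corner₃′)
                                       (lookup-weight w₃)))))
    (∈-shape shape (∈-map⁺ (completionTimes g)
      (∈-cartesianProduct⁺ (∈-vectors ∈-cells r)
        (∈-cartesianProduct⁺ (∈-maybes corner₂)
          (∈-cartesianProduct⁺ (∈-maybes corner₃) (∈-maybes corner₃′))))))
  where
  open Decomposition D
  r = Vec.tabulate cell
  lookup-weight : (w : Cell shape → Job → ℕ) → weight w cell g ≡ weight w (lookup r) g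
  lookup-weight w = sum-cong-≗ (λ k → cong (λ y → w y (g k)) (sym (lookup∘tabulate cell k)))
  ∈-shape : ∀ σ {p} → p ∈ map (completionTimes g) (profiles t σ) → p ∈ candidates g
  ∈-shape viaAC = ∈-++⁺ˡ
  ∈-shape viaBB = ∈-++⁺ʳ _

lemma2p5 : Σ ℕ λ c → Σ ℕ λ k → ∀ (t : ℕ) (jobs : Fin t → Job) →
    Σ (List (ℕ × ℕ)) λ L →
      (length L ≤ c * (suc t ^ k) * (4 ^ t)) ×
      (∀ (π : Permutation′ t) → (CM₂ jobs π , CM₃ jobs π) ∈ L)
lemma2p5 = 2 , 3 , λ t jobs → candidates jobs ,
  ≤-reflexive (length-candidates jobs) ,
  λ π → decomposition-∈-candidates
          (decomposition-unpermute π (decomposition-schedule t (λ k → jobs (π ⟨$⟩ʳ k))))
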